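{- (1) On $\mathcal M_\bullet$, $\partial_{\mathrm{del}}$ and $\partial_{\mathrm{clp}}$ are right coderivations for $\Delta$: $\Delta\circ\partial_{\mathrm{del}}=(\mathrm{id}\otimes\partial_{\mathrm{del}})\circ\Delta$ and $\Delta\circ\partial_{\mathrm{clp}}=(\mathrm{id}\otimes\partial_{\mathrm{clp}})\circ\Delta$. (2) On $\mathcal M_\bullet$, $\partial_{\mathrm{con}}$ and $\partial_{\mathrm{lp}}$ are left coderivations for $\Delta$: $\Delta\circ\partial_{\mathrm{con}}=(\partial_{\mathrm{con}}\otimes\mathrm{id})\circ\Delta$ and $\Delta\circ\partial_{\mathrm{lp}}=(\partial_{\mathrm{lp}}\otimes\mathrm{id})\circ\Delta$.
   Context: An orientation of a matroid $\mathsf M$ is a generator $\eta$ of $\bigwedge^{|E|}\mathbb{Z}\langle E\rangle$, $E=E(\mathsf M)$; $\varnothing$ has orientation $1$. $\mathcal M$ is the $\mathbb{Q}$-vector space spanned by symbols $[\mathsf M,\eta]$ modulo $[\mathsf M,-\eta]=-[\mathsf M,\eta]$ and $[\mathsf M,\eta]=[\mathsf M',\psi_*\eta]$ for every matroid isomorphism $\psi:\mathsf M\to\mathsf M'$ ($\psi_*$ the induced map on top exterior powers), graded by ground-set size ($\mathcal M_\bullet$). Coproduct: $\Delta[\mathsf M,\eta]=\sum_{S\subseteq E}[\mathsf M|S,\eta|S]\otimes[\mathsf M/S,\eta/S]$, where $\eta|S,\eta/S$ are generators of $\bigwedge^{|S|}\mathbb Z\langle S\rangle$, $\bigwedge^{|E\setminus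 S|}\mathbb Z\langle E\setminus S\rangle$ with $(\eta|S)\wedge(\eta/S)=\eta$. With $\iota_x$ interior product ($\iota_x(x\wedge\alpha)=\alpha$): $\partial_{\mathrm{del}}[\mathsf M,\eta]=\sum_{x\text{ not a coloop}}[\mathsf M\setminus x,\iota_x\eta]$, $\partial_{\mathrm{clp}}$ the same sum over coloops, $\partial_{\mathrm{con}}[\mathsf M,\eta]=\sum_{x\text{ not a loop}}[\mathsf M/x,\iota_x\eta]$, $\partial_{\mathrm{lp}}$ the same sum over loops; all have degree $-1$. Koszul convention: for $D$ of degree $d$, $(\mathrm{id}\otimes D)(a\otimes b)=(-1)^{d|a|}a\otimes D(b)$ and $(D\otimes\mathrm{id})(a\otimes b)=D(a)\otimes b$, with $|a|$ the ground-set size. -}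

module Defs where

open import Data.Nat as ℕ using (ℕ; zero; suc; _≤_; _<_)
open import Data.Bool using (Bool; true; false; if_then_else_; _∧_)
open import Data.Fin as Fin using (Fin; toℕ)
open import Data.Fin.Subset using (Subset; inside; outside; _∪_; _∩_; ∁; ⁅_⁆; ⊤; _⊆_)
open import Data.Fin.Permutation using (Permutation′; _⟨$⟩ʳ_)
open import Data.Vec using (Vec; []; _∷_; lookup; tabulate)
open import Data.List as List using (List; []; _∷_; concatMap; map; allFin)
open import Data.Product using (Σ; _×_; _,_; proj₁; proj₂)
open import Data.Nat.ListAction using () renaming (sum to sumℕ)
open import Data.Rational using (ℚ; 0ℚ; 1ℚ; -_; _+_; _*_)
open import Data.List.Relation.Unary.All using (All)
open import Relation.Nullary.Decidable using (⌊_⌋)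
open import Relation.Binary.PropositionalEquality using (_≡_)

neg1^ : ℕ → ℚ
neg1^ zero    = 1ℚ
neg1^ (suc k) = - neg1^ k

countPairs : (n : ℕ) → (Fin n → Fin n → Bool) → ℕ
countPairs n p =
  sumℕ (map (λ i → sumℕ (map (λ j → if p i j then 1 else 0) (allFin n))) (allFin n))

sgn : {n : ℕ} → Permutation′ n → ℚ
sgn {n} ψ = neg1^ (countPairs n (λ i j → ⌊ i Fin.<? j ⌋ ∧ ⌊ (ψ ⟨$⟩ʳ j) Fin.<? (ψ ⟨$⟩ʳ i) ⌋))

sz : {n : ℕ} → Subset n → ℕ
sz []            = 0
sz (true  ∷ S)   = suc (sz S)
sz (false ∷ S)   = sz S

-- order-preserving relabelling: a subset T of Fin (sz S), viewed as a
-- subset of the ground set S (listed increasingly), pushed into Fin n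
push : {n : ℕ} (S : Subset n) → Subset (sz S) → Subset n
push []            T       = []
push (true  ∷ S)   (b ∷ T) = b ∷ push S T
push (false ∷ S)   T       = outside ∷ push S T

subsets : (n : ℕ) → List (Subset n)
subsets zero    = [] ∷ []
subsets (suc n) = concatMap (λ S → (inside ∷ S) ∷ (outside ∷ S) ∷ []) (subsets n)

-- sh S = #{ (i , j) : i < j, i ∉ S, j ∈ S };
-- e_S ∧ e_{E∖S} = (-1)^(sh S) e_E  for the increasing wedge products e_•
sh : {n : ℕ} → Subset n → ℕ
sh {n} S = countPairs n (λ i j → ⌊ i Fin.<? j ⌋ ∧ Data.Bool.not (lookup S i) ∧ lookup S j)
  where import Data.Bool

-- (Raw) matroids on ground set Fin n, given by rank functions.
-- An element (n , r) with canonical orientation e_0 ∧ … ∧ e_{n-1}.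

RM : Set
RM = Σ ℕ (λ n → Subset n → ℕ)

IsMatroid : RM → Set
IsMatroid (n , r) =
  (∀ A → r A ≤ sz A) ×
  (∀ A B → A ⊆ B → r A ≤ r B) ×
  (∀ A B → r (A ∪ B) ℕ.+ r (A ∩ B) ≤ r A ℕ.+ r B)

restrict : (M : RM) → Subset (proj₁ M) → RM
restrict (n , r) S = sz S , λ T → r (push S T)

contract : (M : RM) → Subset (proj₁ M) → RM
contract (n , r) S = sz (∁ S) , λ T → r (push (∁ S) T ∪ S) ℕ.∸ r S

isLoop : (M : RM) → Fin (proj₁ M) → Bool
isLoop (n , r) x = ⌊ r ⁅ x ⁆ ℕ.≟ 0 ⌋

isColoop : (M : RM) → Fin (proj₁ M) → Bool
isColoop (n , r) x = ⌊ r (∁ ⁅ x ⁆) ℕ.<? r ⊤ ⌋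

-- Formal ℚ-combinations.  A term (q , M) stands for q·[M , e_0∧…∧e_{n-1}];
-- the relation [M,-η] = -[M,η] is thereby built in.

FS : Set
FS = List (ℚ × RM)

FS2 : Set
FS2 = List (ℚ × RM × RM)

linExt : (RM → FS) → FS → FS
linExt D = concatMap (λ { (q , M) → map (λ { (c , N) → (q * c , N) }) (D M) })

-- Sum over x with  sel M x = true  of  [op M x , ι_x (e_0∧…∧e_{n-1})],
-- where ι_x (e_0∧…∧e_{n-1}) = (-1)^x (e_0∧…ê_x…∧e_{n-1}) and the minor
-- op M x has ground set E∖x relabelled order-preservingly.
minorGen : (sel : (M : RM) → Fin (proj₁ M) → Bool)
           (op : (M : RM) → Fin (proj₁ M) → RM) → RM → FS
minorGen sel op M =
  concatMap (λ x → if sel M x then (neg1^ (toℕ x) , op M x) ∷ [] else [])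
            (allFin (proj₁ M))

notB : {A : Set} → (A → Bool) → A → Bool
notB p a = if p a then false else true

deleteAt : (M : RM) → Fin (proj₁ M) → RM
deleteAt M x = restrict M (∁ ⁅ x ⁆)

contractAt : (M : RM) → Fin (proj₁ M) → RM
contractAt M x = contract M ⁅ x ⁆

∂delG ∂clpG ∂conG ∂lpG : RM → FS
∂delG = minorGen (λ M → notB (isColoop M)) deleteAt
∂clpG = minorGen isColoop deleteAt
∂conG = minorGen (λ M → notB (isLoop M)) contractAt
∂lpG  = minorGen isLoop contractAt

-- coproduct on generators: Δ[M,η] = Σ_S [M|S, η|S] ⊗ [M/S, η/S]
-- with η|S = (-1)^(sh S) e_S and η/S = e_{E∖S}, so (η|S) ∧ (η/S) = η.
ΔG : RM → FS2
ΔG M = map (λ S → (neg1^ (sh S) , restrict M S , contract M S)) (subsets (proj₁ M))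

Δ : FS → FS2
Δ = concatMap (λ { (q , M) → map (λ { (c , A , B) → (q * c , A , B) }) (ΔG M) })

-- (id ⊗ D)(a ⊗ b) = (-1)^{|a|} a ⊗ D b   (D of degree -1, Koszul sign)
id⊗ : (RM → FS) → FS2 → FS2
id⊗ D = concatMap (λ { (q , A , B) →
          map (λ { (c , B′) → (neg1^ (proj₁ A) * q * c , A , B′) }) (D B) })

⊗id : (RM → FS) → FS2 → FS2
⊗id D = concatMap (λ { (q , A , B) →
          map (λ { (c , A′) → (q * c , A′ , B) }) (D A) })

-- A bilinear functional on M ⊗ M is given by its values g A B on pairs of
-- generators; it is well defined on the quotient iff it respects the
-- isomorphism relation [M,η] = [M',ψ_*η] in each slot, where
-- ψ_*(e_0∧…∧e_{n-1}) = sgn ψ · (e_0∧…∧e_{n-1}).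

preimage : {n : ℕ} → Permutation′ n → Subset n → Subset n
preimage ψ T = tabulate (λ i → lookup T (ψ ⟨$⟩ʳ i))

IsIso : {n : ℕ} → Permutation′ n → (Subset n → ℕ) → (Subset n → ℕ) → Set
IsIso ψ r r′ = ∀ T → r′ T ≡ r (preimage ψ T)

Invariant₂ : (RM → RM → ℚ) → Set
Invariant₂ g =
  (∀ n (r r′ : Subset n → ℕ) (ψ : Permutation′ n) → IsIso ψ r r′ →
     ∀ B → g (n , r′) B ≡ sgn ψ * g (n , r) B) ×
  (∀ n (r r′ : Subset n → ℕ) (ψ : Permutation′ n) → IsIso ψ r r′ →
     ∀ A → g A (n , r′) ≡ sgn ψ * g A (n , r))

eval₂ : (RM → RM → ℚ) → FS2 → ℚ
eval₂ g = List.foldr (λ { (q , A , B) acc → q * g A B + acc }) 0ℚ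

-- equality of elements of M ⊗ M (over ℚ: equal iff all linear functionals agree)
_≈⊗_ : FS2 → FS2 → Set
u ≈⊗ v = (g : RM → RM → ℚ) → Invariant₂ g → eval₂ g u ≡ eval₂ g v

AllMatroid : FS → Set
AllMatroid x = All (λ t → IsMatroid (proj₂ t)) x

{-# OPTIONS --safe #-}

-- Both sides are linear in x, and ≈⊗ is tested against isomorphism-invariant
-- bilinear functionals g, so it suffices to compare g-evaluations on a single
-- matroid M. Deleting x and then splitting along S ⊆ E ∖ x gives the terms
-- (M ∖ x)|S ⊗ (M ∖ x)/S ≅ M|S ⊗ (M/S) ∖ x, and x is a coloop of M exactly when
-- it is one of M/S; exchanging the sums over x and S turns Δ ∂ M into
-- (id ⊗ ∂) Δ M. Dually, contracting x and splitting along S gives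
-- (M/x)|S ⊗ (M/x)/S ≅ (M|U)/x ⊗ M/U with U = S ∪ x, and x is a loop of M
-- exactly when it is one of M|U. The orientations agree because every sign is
-- (-1) to the number of pairs i < j with i ∉ A and j ∈ S for suitable A and S,
-- and the counts on the two sides are congruent modulo 2.

module Submission where

open import Defs
open import Algebra.Bundles using (CommutativeRing)
open import Data.Bool using (Bool; true; false; if_then_else_; _∧_; _∨_; not)
open import Data.Fin as Fin using (Fin; toℕ)
open import Data.Fin.Permutation using () renaming (id to idₚ)
open import Data.Fin.Subset using (Subset; inside; outside; ⁅_⁆; ∁; _∪_; _∩_; ⊤; ⊥; _⊆_)
import Data.Bool.Properties as Boolₚ
import Data.Fin.Properties as Finₚ
import Data.Fin.Subset.Properties as Subsetₚ
open import Data.List as List using (List; []; _∷_; _++_; allFin)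
import Data.List.Properties as Listₚ
open import Data.List.Relation.Unary.All using (All; []; _∷_)
open import Data.Nat as ℕ using (ℕ; zero; suc; _∸_; _≤_)
open import Data.Nat.ListAction using () renaming (sum to sumℕ)
import Data.Nat.Properties as ℕₚ
open import Data.Nat.Tactic.RingSolver using (solve-∀)
open import Data.Product using (Σ; _×_; _,_; proj₁; proj₂)
open import Data.Rational using (ℚ; 0ℚ; 1ℚ; -_; _+_; _*_)
open import Data.Rational.Properties
open import Data.Rational.Solver using (module +-*-Solver)
open import Data.Vec using ([]; _∷_; lookup; toList)
import Data.Vec.Properties as Vecₚ
open import Function using (_∘_; id)
open import Relation.Binary.PropositionalEquality
open import Relation.Nullary.Decidable using (⌊_⌋; yes; no; ⌊⌋-map′)
open import Relation.Nullary.Negation using (contradiction)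

open import Algebra.Properties.Semiring.Sum (CommutativeRing.semiring +-*-commutativeRing)
  using (sum; sum-cong-≗; ∑-distrib-+; *-distribˡ-sum)
import Algebra.Properties.Semiring.Sum ℕₚ.+-*-semiring as ℕΣ
import Algebra.Properties.CommutativeSemigroup (CommutativeRing.+-commutativeSemigroup +-*-commutativeRing) as ℚ+
import Algebra.Properties.CommutativeSemigroup ℕₚ.+-commutativeSemigroup as ℕ+
open +-*-Solver using (solve; _:*_; :-_; _:=_)

-- Finite sums in ℚ

sumOver : {A : Set} → List A → (A → ℚ) → ℚ
sumOver []      f = 0ℚ
sumOver (a ∷ l) f = f a + sumOver l f

sumOver-cong : {A : Set} (l : List A) {f g : A → ℚ} → (∀ a → f a ≡ g a) → sumOver l f ≡ sumOver l g
sumOver-cong []      f≗g = refl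
sumOver-cong (a ∷ l) f≗g = cong₂ _+_ (f≗g a) (sumOver-cong l f≗g)

sumOver-congᴬ : {A : Set} {P : A → Set} (l : List A) → All P l →
                {f g : A → ℚ} → (∀ a → P a → f a ≡ g a) → sumOver l f ≡ sumOver l g
sumOver-congᴬ []      []         f≗g = refl
sumOver-congᴬ (a ∷ l) (pa ∷ pl) f≗g = cong₂ _+_ (f≗g a pa) (sumOver-congᴬ l pl f≗g)

sumOver-++ : {A : Set} (l l′ : List A) (f : A → ℚ) → sumOver (l ++ l′) f ≡ sumOver l f + sumOver l′ f
sumOver-++ []      l′ f = sym (+-identityˡ _)
sumOver-++ (a ∷ l) l′ f = trans (cong (f a +_) (sumOver-++ l l′ f)) (sym (+-assoc (f a) _ _))

sumOver-concatMap : {A B : Set} (k : A → List B) (l : List A) (f : B → ℚ) →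
                    sumOver (List.concatMap k l) f ≡ sumOver l (λ a → sumOver (k a) f)
sumOver-concatMap k []      f = refl
sumOver-concatMap k (a ∷ l) f =
  trans (sumOver-++ (k a) (List.concatMap k l) f) (cong (sumOver (k a) f +_) (sumOver-concatMap k l f))

sumOver-map : {A B : Set} (h : A → B) (l : List A) (f : B → ℚ) → sumOver (List.map h l) f ≡ sumOver l (f ∘ h)
sumOver-map h []      f = refl
sumOver-map h (a ∷ l) f = cong (f (h a) +_) (sumOver-map h l f)

*-distribˡ-sumOver : {A : Set} (c : ℚ) (l : List A) (f : A → ℚ) → c * sumOver l f ≡ sumOver l (λ a → c * f a)
*-distribˡ-sumOver c []      f = *-zeroʳ c
*-distribˡ-sumOver c (a ∷ l) f = trans (*-distribˡ-+ c (f a) _) (cong (c * f a +_) (*-distribˡ-sumOver c l f))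

sumOver-tabulate : {A : Set} (n : ℕ) (h : Fin n → A) (f : A → ℚ) → sumOver (List.tabulate h) f ≡ sum (f ∘ h)
sumOver-tabulate zero    h f = refl
sumOver-tabulate (suc n) h f = cong (f (h Fin.zero) +_) (sumOver-tabulate n (h ∘ Fin.suc) f)

sumOver-allFin : (n : ℕ) (f : Fin n → ℚ) → sumOver (allFin n) f ≡ sum f
sumOver-allFin n = sumOver-tabulate n id

∑ₛ : (n : ℕ) → (Subset n → ℚ) → ℚ
∑ₛ zero    f = f []
∑ₛ (suc n) f = ∑ₛ n (λ S → f (inside ∷ S) + f (outside ∷ S))

∑ₛ-cong : (n : ℕ) {f g : Subset n → ℚ} → (∀ S → f S ≡ g S) → ∑ₛ n f ≡ ∑ₛ n g
∑ₛ-cong zero    f≗g = f≗g []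
∑ₛ-cong (suc n) f≗g = ∑ₛ-cong n (λ S → cong₂ _+_ (f≗g (inside ∷ S)) (f≗g (outside ∷ S)))

∑ₛ-zero : (n : ℕ) → ∑ₛ n (λ _ → 0ℚ) ≡ 0ℚ
∑ₛ-zero zero    = refl
∑ₛ-zero (suc n) = trans (∑ₛ-cong n (λ _ → +-identityˡ 0ℚ)) (∑ₛ-zero n)

∑ₛ-distrib-+ : (n : ℕ) (f g : Subset n → ℚ) → ∑ₛ n (λ S → f S + g S) ≡ ∑ₛ n f + ∑ₛ n g
∑ₛ-distrib-+ zero    f g = refl
∑ₛ-distrib-+ (suc n) f g =
  trans (∑ₛ-cong n (λ S → ℚ+.interchange (f (inside ∷ S)) (g (inside ∷ S)) (f (outside ∷ S)) (g (outside ∷ S))))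
        (∑ₛ-distrib-+ n _ _)

*-distribˡ-∑ₛ : (n : ℕ) (c : ℚ) (f : Subset n → ℚ) → c * ∑ₛ n f ≡ ∑ₛ n (λ S → c * f S)
*-distribˡ-∑ₛ zero    c f = refl
*-distribˡ-∑ₛ (suc n) c f =
  trans (*-distribˡ-∑ₛ n c _) (∑ₛ-cong n (λ S → *-distribˡ-+ c (f (inside ∷ S)) (f (outside ∷ S))))

∑-∑ₛ-comm : (m n : ℕ) (f : Fin m → Subset n → ℚ) → sum (λ x → ∑ₛ n (f x)) ≡ ∑ₛ n (λ S → sum (λ x → f x S))
∑-∑ₛ-comm zero    n f = sym (∑ₛ-zero n)
∑-∑ₛ-comm (suc m) n f =
  trans (cong (∑ₛ n (f Fin.zero) +_) (∑-∑ₛ-comm m n (f ∘ Fin.suc))) (sym (∑ₛ-distrib-+ n _ _))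

sumOver-subsets : (n : ℕ) (f : Subset n → ℚ) → sumOver (subsets n) f ≡ ∑ₛ n f
sumOver-subsets zero    f = +-identityʳ _
sumOver-subsets (suc n) f =
  trans (sumOver-concatMap _ (subsets n) f)
  (trans (sumOver-subsets n _) (∑ₛ-cong n (λ S → cong (f (inside ∷ S) +_) (+-identityʳ _))))

infixr 8 [_]·_
[_]·_ : Bool → ℚ → ℚ
[ b ]· q = if b then q else 0ℚ

[]·-zero : (b : Bool) → [ b ]· 0ℚ ≡ 0ℚ
[]·-zero true  = refl
[]·-zero false = refl

*-[]· : (c : ℚ) (b : Bool) (q : ℚ) → c * [ b ]· q ≡ [ b ]· (c * q)
*-[]· c true  q = refl
*-[]· c false q = *-zeroʳ c

[]·-∑ₛ : (n : ℕ) (b : Bool) (f : Subset n → ℚ) → [ b ]· ∑ₛ n f ≡ ∑ₛ n (λ S → [ b ]· f S)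
[]·-∑ₛ n true  f = refl
[]·-∑ₛ n false f = sym (∑ₛ-zero n)

[]·-*-∑ₛ : (n : ℕ) (b : Bool) (c : ℚ) (f : Subset n → ℚ) → [ b ]· (c * ∑ₛ n f) ≡ ∑ₛ n (λ S → [ b ]· (c * f S))
[]·-*-∑ₛ n b c f = trans (cong [ b ]·_ (*-distribˡ-∑ₛ n c f)) ([]·-∑ₛ n b _)

move-sign : (b : Bool) (a s t : ℚ) {u G : ℚ} → a * s ≡ t * u → [ b ]· (a * (s * G)) ≡ t * [ b ]· (u * G)
move-sign b a s t {u} {G} as≡tu =
  trans (cong [ b ]·_ (trans (sym (*-assoc a s G)) (trans (cong (_* G) as≡tu) (*-assoc t u G))))
        (sym (*-[]· t b (u * G)))

-- Relabelling along a ground set A ⊆ Fin n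

sz-push : {n : ℕ} (A : Subset n) (S : Subset (sz A)) → sz (push A S) ≡ sz S
sz-push []          []          = refl
sz-push (true  ∷ A) (true  ∷ S) = cong suc (sz-push A S)
sz-push (true  ∷ A) (false ∷ S) = sz-push A S
sz-push (false ∷ A) S           = sz-push A S

push-∪ : {n : ℕ} (A : Subset n) (S T : Subset (sz A)) → push A (S ∪ T) ≡ push A S ∪ push A T
push-∪ []          []      []      = refl
push-∪ (true  ∷ A) (s ∷ S) (t ∷ T) = cong ((s ∨ t) ∷_) (push-∪ A S T)
push-∪ (false ∷ A) S       T       = cong (outside ∷_) (push-∪ A S T)

push-∁ : {n : ℕ} (A : Subset n) (S : Subset (sz A)) → push A (∁ S) ≡ A ∩ ∁ (push A S)
push-∁ []          []      = refl
push-∁ (true  ∷ A) (s ∷ S) = cong (not s ∷_) (push-∁ A S)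
push-∁ (false ∷ A) S       = cong (outside ∷_) (push-∁ A S)

push-⊤ : {n : ℕ} (A : Subset n) → push A ⊤ ≡ A
push-⊤ []          = refl
push-⊤ (true  ∷ A) = cong (inside ∷_) (push-⊤ A)
push-⊤ (false ∷ A) = cong (outside ∷_) (push-⊤ A)

push-⊥ : {n : ℕ} (A : Subset n) → push A ⊥ ≡ ⊥
push-⊥ []          = refl
push-⊥ (true  ∷ A) = cong (outside ∷_) (push-⊥ A)
push-⊥ (false ∷ A) = cong (outside ∷_) (push-⊥ A)

push-push : {n : ℕ} (A : Subset n) (B : Subset (sz A)) (T : Subset (sz B)) (T′ : Subset (sz (push A B))) →
            toList T ≡ toList T′ → push A (push B T) ≡ push (push A B) T′
push-push []          []          []      []        T≡T′ = refl
push-push (true  ∷ A) (true  ∷ B) (t ∷ T) (t′ ∷ T′) T≡T′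
  rewrite Listₚ.∷-injectiveˡ T≡T′ = cong (t′ ∷_) (push-push A B T T′ (Listₚ.∷-injectiveʳ T≡T′))
push-push (true  ∷ A) (false ∷ B) T       T′        T≡T′ = cong (outside ∷_) (push-push A B T T′ T≡T′)
push-push (false ∷ A) B           T       T′        T≡T′ = cong (outside ∷_) (push-push A B T T′ T≡T′)

pushFin : {n : ℕ} (A : Subset n) → Fin (sz A) → Fin n
pushFin (true  ∷ A) Fin.zero    = Fin.zero
pushFin (true  ∷ A) (Fin.suc y) = Fin.suc (pushFin A y)
pushFin (false ∷ A) y           = Fin.suc (pushFin A y)

position : {n : ℕ} → Subset n → Fin n → ℕ
position (a ∷ A) Fin.zero    = 0
position (a ∷ A) (Fin.suc x) = (if a then 1 else 0) ℕ.+ position A x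

toℕ≡position-pushFin : {n : ℕ} (A : Subset n) (y : Fin (sz A)) → toℕ y ≡ position A (pushFin A y)
toℕ≡position-pushFin (true  ∷ A) Fin.zero    = refl
toℕ≡position-pushFin (true  ∷ A) (Fin.suc y) = cong suc (toℕ≡position-pushFin A y)
toℕ≡position-pushFin (false ∷ A) y           = toℕ≡position-pushFin A y

push-⁅⁆ : {n : ℕ} (A : Subset n) (y : Fin (sz A)) → push A ⁅ y ⁆ ≡ ⁅ pushFin A y ⁆
push-⁅⁆ (true  ∷ A) Fin.zero    = cong (inside ∷_) (push-⊥ A)
push-⁅⁆ (true  ∷ A) (Fin.suc y) = cong (outside ∷_) (push-⁅⁆ A y)
push-⁅⁆ (false ∷ A) y           = cong (outside ∷_) (push-⁅⁆ A y)

lookup-pushFin : {n : ℕ} (A : Subset n) (y : Fin (sz A)) → lookup A (pushFin A y) ≡ true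
lookup-pushFin (true  ∷ A) Fin.zero    = refl
lookup-pushFin (true  ∷ A) (Fin.suc y) = lookup-pushFin A y
lookup-pushFin (false ∷ A) y           = lookup-pushFin A y

push-∁⁅⁆ : {n : ℕ} (A : Subset n) (y : Fin (sz A)) → push A (∁ ⁅ y ⁆) ≡ A ∩ ∁ ⁅ pushFin A y ⁆
push-∁⁅⁆ A y = trans (push-∁ A ⁅ y ⁆) (cong (λ X → A ∩ ∁ X) (push-⁅⁆ A y))

∉-pushFin-∁ : {n : ℕ} (S : Subset n) (y : Fin (sz (∁ S))) → lookup S (pushFin (∁ S) y) ≡ false
∉-pushFin-∁ S y = Boolₚ.not-injective (trans (sym (Vecₚ.lookup-map (pushFin (∁ S) y) not S)) (lookup-pushFin (∁ S) y))

_⊆ᵇ_ : {n : ℕ} → Subset n → Subset n → Bool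
[]      ⊆ᵇ []      = true
(s ∷ S) ⊆ᵇ (a ∷ A) = (not s ∨ a) ∧ (S ⊆ᵇ A)

∑ₛ-push : {n : ℕ} (A : Subset n) (H : Subset n → ℚ) → ∑ₛ (sz A) (H ∘ push A) ≡ ∑ₛ n (λ S → [ S ⊆ᵇ A ]· H S)
∑ₛ-push []          H = refl
∑ₛ-push {suc n} (true ∷ A) H = begin
  ∑ₛ (sz A) (λ S → H (inside ∷ push A S) + H (outside ∷ push A S))
    ≡⟨ ∑ₛ-distrib-+ (sz A) _ _ ⟩
  ∑ₛ (sz A) (λ S → H (inside ∷ push A S)) + ∑ₛ (sz A) (λ S → H (outside ∷ push A S))
    ≡⟨ cong₂ _+_ (∑ₛ-push A (H ∘ (inside ∷_))) (∑ₛ-push A (H ∘ (outside ∷_))) ⟩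
  ∑ₛ n (λ S → [ S ⊆ᵇ A ]· H (inside ∷ S)) + ∑ₛ n (λ S → [ S ⊆ᵇ A ]· H (outside ∷ S))
    ≡⟨ ∑ₛ-distrib-+ n _ _ ⟨
  ∑ₛ n (λ S → [ S ⊆ᵇ A ]· H (inside ∷ S) + [ S ⊆ᵇ A ]· H (outside ∷ S))
    ∎
  where open ≡-Reasoning
∑ₛ-push {suc n} (false ∷ A) H =
  trans (∑ₛ-push A (H ∘ (outside ∷_))) (∑ₛ-cong n (λ S → sym (+-identityˡ _)))

⊆ᵇ-∁⊥ : {n : ℕ} (S : Subset n) → S ⊆ᵇ ∁ ⊥ ≡ true
⊆ᵇ-∁⊥ []          = refl
⊆ᵇ-∁⊥ (true  ∷ S) = ⊆ᵇ-∁⊥ S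
⊆ᵇ-∁⊥ (false ∷ S) = ⊆ᵇ-∁⊥ S

⊆ᵇ-∁⁅⁆ : {n : ℕ} (S : Subset n) (x : Fin n) → S ⊆ᵇ ∁ ⁅ x ⁆ ≡ not (lookup S x)
⊆ᵇ-∁⁅⁆ (true  ∷ S) Fin.zero    = refl
⊆ᵇ-∁⁅⁆ (false ∷ S) Fin.zero    = ⊆ᵇ-∁⊥ S
⊆ᵇ-∁⁅⁆ (true  ∷ S) (Fin.suc x) = ⊆ᵇ-∁⁅⁆ S x
⊆ᵇ-∁⁅⁆ (false ∷ S) (Fin.suc x) = ⊆ᵇ-∁⁅⁆ S x

sum-pushFin : {n : ℕ} (A : Subset n) (H : Fin n → ℚ) → sum (H ∘ pushFin A) ≡ sum (λ x → [ lookup A x ]· H x)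
sum-pushFin []          H = refl
sum-pushFin (true  ∷ A) H = cong (H Fin.zero +_) (sum-pushFin A (H ∘ Fin.suc))
sum-pushFin (false ∷ A) H = trans (sum-pushFin A (H ∘ Fin.suc)) (sym (+-identityˡ _))

∑ₛ-insert : (n : ℕ) (x : Fin n) (F : Subset n → ℚ) →
            ∑ₛ n (λ U → [ lookup U x ]· F U) ≡ ∑ₛ n (λ S → [ not (lookup S x) ]· F (S ∪ ⁅ x ⁆))
∑ₛ-insert (suc n) Fin.zero F =
  ∑ₛ-cong n (λ S → trans (+-identityʳ _)
                   (trans (cong (F ∘ (inside ∷_)) (sym (Subsetₚ.∪-identityʳ S))) (sym (+-identityˡ _))))
∑ₛ-insert (suc n) (Fin.suc x) F =
  trans (∑ₛ-distrib-+ n _ _)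
  (trans (cong₂ _+_ (∑ₛ-insert n x (F ∘ (inside ∷_))) (∑ₛ-insert n x (F ∘ (outside ∷_))))
         (sym (∑ₛ-distrib-+ n _ _)))

∁⊥≡⊤ : {n : ℕ} → ∁ ⊥ ≡ ⊤ {n}
∁⊥≡⊤ = Vecₚ.map-replicate not false _

∩-∁⁅⁆ : {n : ℕ} (S : Subset n) (x : Fin n) → lookup S x ≡ false → S ∩ ∁ ⁅ x ⁆ ≡ S
∩-∁⁅⁆ (false ∷ S) Fin.zero    x∉S = cong (outside ∷_) (trans (cong (S ∩_) ∁⊥≡⊤) (Subsetₚ.∩-identityʳ S))
∩-∁⁅⁆ (true  ∷ S) (Fin.suc x) x∉S = cong (inside ∷_) (∩-∁⁅⁆ S x x∉S)
∩-∁⁅⁆ (false ∷ S) (Fin.suc x) x∉S = cong (outside ∷_) (∩-∁⁅⁆ S x x∉S)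

⊆-∁⁅⁆ : {n : ℕ} (S : Subset n) (x : Fin n) → lookup S x ≡ false → S ⊆ ∁ ⁅ x ⁆
⊆-∁⁅⁆ S x x∉S = subst (_⊆ ∁ ⁅ x ⁆) (∩-∁⁅⁆ S x x∉S) (Subsetₚ.p∩q⊆q S (∁ ⁅ x ⁆))

∁⁅⁆-∪ : {n : ℕ} (S : Subset n) (x : Fin n) → lookup S x ≡ false → ∁ ⁅ x ⁆ ∪ S ≡ ∁ ⁅ x ⁆
∁⁅⁆-∪ S x x∉S = begin
  ∁ ⁅ x ⁆ ∪ S               ≡⟨ cong (∁ ⁅ x ⁆ ∪_) (∩-∁⁅⁆ S x x∉S) ⟨
  ∁ ⁅ x ⁆ ∪ (S ∩ ∁ ⁅ x ⁆)   ≡⟨ cong (∁ ⁅ x ⁆ ∪_) (Subsetₚ.∩-comm S _) ⟩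
  ∁ ⁅ x ⁆ ∪ (∁ ⁅ x ⁆ ∩ S)   ≡⟨ Subsetₚ.∪-abs-∩ (∁ ⁅ x ⁆) S ⟩
  ∁ ⁅ x ⁆                   ∎
  where open ≡-Reasoning

∪⁅⁆-∩-∁⁅⁆ : {n : ℕ} (S : Subset n) (x : Fin n) → lookup S x ≡ false → (S ∪ ⁅ x ⁆) ∩ ∁ ⁅ x ⁆ ≡ S
∪⁅⁆-∩-∁⁅⁆ S x x∉S = begin
  (S ∪ ⁅ x ⁆) ∩ ∁ ⁅ x ⁆                  ≡⟨ Subsetₚ.∩-distribʳ-∪ (∁ ⁅ x ⁆) S ⁅ x ⁆ ⟩
  (S ∩ ∁ ⁅ x ⁆) ∪ (⁅ x ⁆ ∩ ∁ ⁅ x ⁆)      ≡⟨ cong₂ _∪_ (∩-∁⁅⁆ S x x∉S) (Subsetₚ.∩-inverseʳ ⁅ x ⁆) ⟩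
  S ∪ ⊥                                  ≡⟨ Subsetₚ.∪-identityʳ S ⟩
  S                                      ∎
  where open ≡-Reasoning

-- Orientation signs

neg1^-+ : (a b : ℕ) → neg1^ (a ℕ.+ b) ≡ neg1^ a * neg1^ b
neg1^-+ zero    b = sym (*-identityˡ _)
neg1^-+ (suc a) b = trans (cong -_ (neg1^-+ a b)) (neg-distribˡ-* (neg1^ a) (neg1^ b))

neg1^-square : (a : ℕ) → neg1^ a * neg1^ a ≡ 1ℚ
neg1^-square zero    = refl
neg1^-square (suc a) = trans (neg*neg (neg1^ a)) (neg1^-square a)
  where
  neg*neg : (p : ℚ) → (- p) * (- p) ≡ p * p
  neg*neg = solve 1 (λ p → (:- p) :* (:- p) := p :* p) refl

neg1^-+-double : (a c : ℕ) → neg1^ (a ℕ.+ (c ℕ.+ c)) ≡ neg1^ a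
neg1^-+-double a c = begin
  neg1^ (a ℕ.+ (c ℕ.+ c))       ≡⟨ neg1^-+ a (c ℕ.+ c) ⟩
  neg1^ a * neg1^ (c ℕ.+ c)     ≡⟨ cong (neg1^ a *_) (neg1^-+ c c) ⟩
  neg1^ a * (neg1^ c * neg1^ c) ≡⟨ cong (neg1^ a *_) (neg1^-square c) ⟩
  neg1^ a * 1ℚ                  ≡⟨ *-identityʳ _ ⟩
  neg1^ a                       ∎
  where open ≡-Reasoning

sumℕ-allFin : (n : ℕ) (f : Fin n → ℕ) → sumℕ (List.map f (allFin n)) ≡ ℕΣ.sum f
sumℕ-allFin zero    f = refl
sumℕ-allFin (suc n) f =
  cong (f Fin.zero ℕ.+_)
       (trans (cong sumℕ (trans (Listₚ.map-tabulate Fin.suc f) (sym (Listₚ.map-tabulate id (f ∘ Fin.suc)))))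
              (sumℕ-allFin n (f ∘ Fin.suc)))

countPairs-sum : (n : ℕ) (p : Fin n → Fin n → Bool) →
                 countPairs n p ≡ ℕΣ.sum (λ i → ℕΣ.sum (λ j → if p i j then 1 else 0))
countPairs-sum n p =
  trans (sumℕ-allFin n _) (ℕΣ.sum-cong-≗ (λ i → sumℕ-allFin n (λ j → if p i j then 1 else 0)))

countPairs-none : (n : ℕ) (p : Fin n → Fin n → Bool) → (∀ i j → p i j ≡ false) → countPairs n p ≡ 0
countPairs-none n p none =
  trans (countPairs-sum n p)
  (trans (ℕΣ.sum-cong-≗ (λ i → trans (ℕΣ.sum-cong-≗ (λ j → cong (λ b → if b then 1 else 0) (none i j)))
                                      (ℕΣ.sum-replicate-zero n)))
         (ℕΣ.sum-replicate-zero n))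

sgn-id : (n : ℕ) → sgn {n} idₚ ≡ 1ℚ
sgn-id n = cong neg1^ (countPairs-none n _ asym)
  where
  asym : (i j : Fin n) → ⌊ i Fin.<? j ⌋ ∧ ⌊ j Fin.<? i ⌋ ≡ false
  asym i j with i Fin.<? j | j Fin.<? i
  ... | yes i<j | yes j<i = contradiction j<i (Finₚ.<-asym i<j)
  ... | yes _   | no _    = refl
  ... | no _    | _       = refl

crossings : {n : ℕ} → Subset n → Subset n → ℕ
crossings []      []      = 0
crossings (a ∷ A) (b ∷ S) = (if a then 0 else sz S) ℕ.+ crossings A S

sz-sum : {n : ℕ} (S : Subset n) → ℕΣ.sum (λ j → if lookup S j then 1 else 0) ≡ sz S
sz-sum []          = refl
sz-sum (true  ∷ S) = cong suc (sz-sum S)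
sz-sum (false ∷ S) = sz-sum S

⌊suc<?suc⌋ : {n : ℕ} (i j : Fin n) → ⌊ Fin.suc i Fin.<? Fin.suc j ⌋ ≡ ⌊ i Fin.<? j ⌋
⌊suc<?suc⌋ i j = trans (⌊⌋-map′ _ _ _) (sym (⌊⌋-map′ _ _ _))

sh-∷ : {n : ℕ} (b : Bool) (S : Subset n) → sh (b ∷ S) ≡ (if b then 0 else sz S) ℕ.+ sh S
sh-∷ {n} b S =
  trans (countPairs-sum (suc n) (shuffled (b ∷ S)))
        (cong₂ ℕ._+_ (firstRow b) (trans (ℕΣ.sum-cong-≗ (ℕΣ.sum-cong-≗ ∘ laterRows)) (sym (countPairs-sum n (shuffled S)))))
  where
  shuffled : {m : ℕ} → Subset m → Fin m → Fin m → Bool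
  shuffled T i j = ⌊ i Fin.<? j ⌋ ∧ not (lookup T i) ∧ lookup T j
  firstRow : (b : Bool) → ℕΣ.sum (λ j → if not b ∧ lookup S j then 1 else 0) ≡ (if b then 0 else sz S)
  firstRow true  = ℕΣ.sum-replicate-zero n
  firstRow false = sz-sum S
  laterRows : (i j : Fin n) → (if shuffled (b ∷ S) (Fin.suc i) (Fin.suc j) then 1 else 0) ≡ (if shuffled S i j then 1 else 0)
  laterRows i j = cong (λ c → if c ∧ not (lookup S i) ∧ lookup S j then 1 else 0) (⌊suc<?suc⌋ i j)

sh≡crossings : {n : ℕ} (S : Subset n) → sh S ≡ crossings S S
sh≡crossings []      = refl
sh≡crossings (b ∷ S) = trans (sh-∷ b S) (cong ((if b then 0 else sz S) ℕ.+_) (sh≡crossings S))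

crossings-push : {n : ℕ} (A : Subset n) (S : Subset (sz A)) →
                 crossings (push A S) (push A S) ≡ crossings S S ℕ.+ crossings A (push A S)
crossings-push []          []          = refl
crossings-push (true  ∷ A) (true  ∷ S) = crossings-push A S
crossings-push (true  ∷ A) (false ∷ S)
  rewrite crossings-push A S | sz-push A S = sym (ℕₚ.+-assoc (sz S) (crossings S S) _)
crossings-push (false ∷ A) S
  rewrite crossings-push A S = ℕ+.x∙yz≈y∙xz (sz (push A S)) (crossings S S) _

crossings-∁⊥ : {n : ℕ} (S : Subset n) → crossings (∁ ⊥) S ≡ 0
crossings-∁⊥ []      = refl
crossings-∁⊥ (b ∷ S) = crossings-∁⊥ S

crossings-delete : {n : ℕ} (S : Subset n) (x : Fin n) → lookup S x ≡ false →
                   toℕ x ℕ.+ crossings (∁ ⁅ x ⁆) S ≡ sz S ℕ.+ position (∁ S) x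
crossings-delete (false ∷ S) Fin.zero    x∉S = cong (sz S ℕ.+_) (crossings-∁⊥ S)
crossings-delete (true  ∷ S) (Fin.suc x) x∉S = cong suc (crossings-delete S x x∉S)
crossings-delete (false ∷ S) (Fin.suc x) x∉S =
  trans (cong suc (crossings-delete S x x∉S)) (sym (ℕₚ.+-suc (sz S) _))

sz-∪⁅⁆ : {n : ℕ} (S : Subset n) (x : Fin n) → lookup S x ≡ false → sz (S ∪ ⁅ x ⁆) ≡ suc (sz S)
sz-∪⁅⁆ (false ∷ S) Fin.zero    x∉S = cong (suc ∘ sz) (Subsetₚ.∪-identityʳ S)
sz-∪⁅⁆ (true  ∷ S) (Fin.suc x) x∉S = cong suc (sz-∪⁅⁆ S x x∉S)
sz-∪⁅⁆ (false ∷ S) (Fin.suc x) x∉S = sz-∪⁅⁆ S x x∉S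

crossings-insert : {n : ℕ} (S : Subset n) (x : Fin n) → lookup S x ≡ false →
                   let U = S ∪ ⁅ x ⁆ in
                   crossings U U ℕ.+ position U x ℕ.+ crossings (∁ ⁅ x ⁆) S ≡ crossings S S ℕ.+ toℕ x
crossings-insert (false ∷ S) Fin.zero x∉S
  rewrite Subsetₚ.∪-identityʳ S | crossings-∁⊥ S = arith (crossings S S) (sz S)
  where
  arith : ∀ c s → c ℕ.+ 0 ℕ.+ (s ℕ.+ 0) ≡ s ℕ.+ c ℕ.+ 0
  arith = solve-∀
crossings-insert (true ∷ S) (Fin.suc x) x∉S =
  trans (arith (crossings U U) (position U x) (crossings (∁ ⁅ x ⁆) S))
        (trans (cong suc (crossings-insert S x x∉S)) (sym (ℕₚ.+-suc (crossings S S) (toℕ x))))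
  where
  U = S ∪ ⁅ x ⁆
  arith : ∀ c p d → c ℕ.+ suc p ℕ.+ d ≡ suc (c ℕ.+ p ℕ.+ d)
  arith = solve-∀
crossings-insert (false ∷ S) (Fin.suc x) x∉S
  rewrite sz-∪⁅⁆ S x x∉S =
  trans (arith₁ (sz S) (crossings U U) (position U x) (crossings (∁ ⁅ x ⁆) S))
        (trans (cong (suc ∘ (sz S ℕ.+_)) (crossings-insert S x x∉S)) (arith₂ (sz S) (crossings S S) (toℕ x)))
  where
  U = S ∪ ⁅ x ⁆
  arith₁ : ∀ s c p d → suc s ℕ.+ c ℕ.+ p ℕ.+ d ≡ suc (s ℕ.+ (c ℕ.+ p ℕ.+ d))
  arith₁ = solve-∀
  arith₂ : ∀ s c y → suc (s ℕ.+ (c ℕ.+ y)) ≡ s ℕ.+ c ℕ.+ suc y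
  arith₂ = solve-∀

sign-push : {n : ℕ} (A : Subset n) (S : Subset (sz A)) →
            neg1^ (sh S) ≡ neg1^ (sh (push A S) ℕ.+ crossings A (push A S))
sign-push A S = sym (trans (cong neg1^ exponent) (neg1^-+-double (sh S) c))
  where
  c = crossings A (push A S)
  exponent : sh (push A S) ℕ.+ c ≡ sh S ℕ.+ (c ℕ.+ c)
  exponent = begin
    sh (push A S) ℕ.+ c                ≡⟨ cong (ℕ._+ c) (trans (sh≡crossings (push A S)) (crossings-push A S)) ⟩
    crossings S S ℕ.+ c ℕ.+ c          ≡⟨ ℕₚ.+-assoc (crossings S S) c c ⟩
    crossings S S ℕ.+ (c ℕ.+ c)        ≡⟨ cong (ℕ._+ (c ℕ.+ c)) (sh≡crossings S) ⟨
    sh S ℕ.+ (c ℕ.+ c)                 ∎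
    where open ≡-Reasoning

sign-delete : {n : ℕ} (S : Subset n) (x : Fin n) → lookup S x ≡ false →
              neg1^ (toℕ x) * neg1^ (sh S ℕ.+ crossings (∁ ⁅ x ⁆) S) ≡
              neg1^ (sh S) * neg1^ (sz S ℕ.+ position (∁ S) x)
sign-delete S x x∉S = begin
  neg1^ (toℕ x) * neg1^ (sh S ℕ.+ c)       ≡⟨ neg1^-+ (toℕ x) _ ⟨
  neg1^ (toℕ x ℕ.+ (sh S ℕ.+ c))           ≡⟨ cong neg1^ (ℕ+.x∙yz≈y∙xz (toℕ x) (sh S) c) ⟩
  neg1^ (sh S ℕ.+ (toℕ x ℕ.+ c))           ≡⟨ cong (neg1^ ∘ (sh S ℕ.+_)) (crossings-delete S x x∉S) ⟩
  neg1^ (sh S ℕ.+ (sz S ℕ.+ position (∁ S) x)) ≡⟨ neg1^-+ (sh S) _ ⟩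
  neg1^ (sh S) * neg1^ (sz S ℕ.+ position (∁ S) x) ∎
  where
  open ≡-Reasoning
  c = crossings (∁ ⁅ x ⁆) S

sign-insert : {n : ℕ} (S : Subset n) (x : Fin n) → lookup S x ≡ false →
              neg1^ (toℕ x) * neg1^ (sh S ℕ.+ crossings (∁ ⁅ x ⁆) S) ≡
              neg1^ (sh (S ∪ ⁅ x ⁆)) * neg1^ (position (S ∪ ⁅ x ⁆) x)
sign-insert S x x∉S = begin
  neg1^ (toℕ x) * neg1^ (sh S ℕ.+ c)          ≡⟨ neg1^-+ (toℕ x) _ ⟨
  neg1^ (toℕ x ℕ.+ (sh S ℕ.+ c))              ≡⟨ cong neg1^ exponent ⟩
  neg1^ (sh U ℕ.+ position U x ℕ.+ (c ℕ.+ c)) ≡⟨ neg1^-+-double (sh U ℕ.+ position U x) c ⟩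
  neg1^ (sh U ℕ.+ position U x)               ≡⟨ neg1^-+ (sh U) _ ⟩
  neg1^ (sh U) * neg1^ (position U x)         ∎
  where
  open ≡-Reasoning
  U = S ∪ ⁅ x ⁆
  c = crossings (∁ ⁅ x ⁆) S
  exponent : toℕ x ℕ.+ (sh S ℕ.+ c) ≡ sh U ℕ.+ position U x ℕ.+ (c ℕ.+ c)
  exponent = begin
    toℕ x ℕ.+ (sh S ℕ.+ c)                        ≡⟨ ℕ+.x∙yz≈yx∙z (toℕ x) (sh S) c ⟩
    sh S ℕ.+ toℕ x ℕ.+ c                          ≡⟨ cong (λ e → e ℕ.+ toℕ x ℕ.+ c) (sh≡crossings S) ⟩
    crossings S S ℕ.+ toℕ x ℕ.+ c                 ≡⟨ cong (ℕ._+ c) (crossings-insert S x x∉S) ⟨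
    crossings U U ℕ.+ position U x ℕ.+ c ℕ.+ c    ≡⟨ ℕₚ.+-assoc _ c c ⟩
    crossings U U ℕ.+ position U x ℕ.+ (c ℕ.+ c)  ≡⟨ cong (λ e → e ℕ.+ position U x ℕ.+ (c ℕ.+ c)) (sh≡crossings U) ⟨
    sh U ℕ.+ position U x ℕ.+ (c ℕ.+ c)           ∎

-- Minors

-- Equality of rank functions across a propositional equality of ground-set sizes.
infix 4 _≅_
_≅_ : RM → RM → Set
(n , r) ≅ (m , r′) = Σ (n ≡ m) λ _ → ∀ T T′ → toList T ≡ toList T′ → r T ≡ r′ T′

≡⇒≅ : {M M′ : RM} → M ≡ M′ → M ≅ M′
≡⇒≅ {n , r} refl = refl , λ T T′ T≡T′ → cong r (toList-injective T T′ T≡T′)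
  where
  toList-injective : {m : ℕ} (T T′ : Subset m) → toList T ≡ toList T′ → T ≡ T′
  toList-injective T T′ T≡T′ = trans (sym (Vecₚ.cast-is-id refl T)) (Vecₚ.toList-injective refl T T′ T≡T′)

≅-trans : {M M′ M″ : RM} → M ≅ M′ → M′ ≅ M″ → M ≅ M″
≅-trans {n , _} {.n , _} {.n , _} (refl , r≗r′) (refl , r′≗r″) =
  refl , λ T T″ T≡T″ → trans (r≗r′ T T″ T≡T″) (r′≗r″ T″ T″ refl)

-- Invariance under the identity permutation, of sign 1, is what lets g see rank functions only pointwise.
module _ (g : RM → RM → ℚ) (g-inv : Invariant₂ g) where

  private
    idₚ-isIso : {n : ℕ} (r r′ : Subset n → ℕ) → (∀ T → r T ≡ r′ T) → IsIso idₚ r r′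
    idₚ-isIso r r′ r≗r′ T = trans (sym (r≗r′ T)) (cong r (sym (Vecₚ.tabulate∘lookup T)))

  invariant-congˡ : {M M′ : RM} → M ≅ M′ → (N : RM) → g M N ≡ g M′ N
  invariant-congˡ {n , r} {.n , r′} (refl , r≗r′) N = sym (begin
    g (n , r′) N          ≡⟨ proj₁ g-inv n r r′ idₚ (idₚ-isIso r r′ (λ T → r≗r′ T T refl)) N ⟩
    sgn {n} idₚ * g (n , r) N ≡⟨ cong (_* g (n , r) N) (sgn-id n) ⟩
    1ℚ * g (n , r) N      ≡⟨ *-identityˡ _ ⟩
    g (n , r) N           ∎)
    where open ≡-Reasoning

  invariant-congʳ : (M : RM) {N N′ : RM} → N ≅ N′ → g M N ≡ g M N′
  invariant-congʳ M {n , r} {.n , r′} (refl , r≗r′) = sym (begin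
    g M (n , r′)          ≡⟨ proj₂ g-inv n r r′ idₚ (idₚ-isIso r r′ (λ T → r≗r′ T T refl)) M ⟩
    sgn {n} idₚ * g M (n , r) ≡⟨ cong (_* g M (n , r)) (sgn-id n) ⟩
    1ℚ * g M (n , r)      ≡⟨ *-identityˡ _ ⟩
    g M (n , r)           ∎)
    where open ≡-Reasoning

  invariant-cong : {M M′ N N′ : RM} → M ≅ M′ → N ≅ N′ → g M N ≡ g M′ N′
  invariant-cong {M′ = M′} {N} M≅M′ N≅N′ = trans (invariant-congˡ M≅M′ N) (invariant-congʳ M′ N≅N′)

-- minor r B C is the minor (M / C) | B of M = (n , r), for disjoint B and C.
minor : {n : ℕ} → (Subset n → ℕ) → Subset n → Subset n → RM
minor r B C = sz B , λ T → r (push B T ∪ C) ∸ r C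

Monotone : {n : ℕ} → (Subset n → ℕ) → Set
Monotone r = ∀ A B → A ⊆ B → r A ≤ r B

[m∸o]∸[n∸o]≡m∸n : (m n o : ℕ) → o ≤ n → (m ∸ o) ∸ (n ∸ o) ≡ m ∸ n
[m∸o]∸[n∸o]≡m∸n m n o o≤n = trans (ℕₚ.∸-+-assoc m o (n ∸ o)) (cong (m ∸_) (ℕₚ.m+[n∸m]≡n o≤n))

⌊∸<?∸⌋ : (m n o : ℕ) → o ≤ m → o ≤ n → ⌊ (m ∸ o) ℕ.<? (n ∸ o) ⌋ ≡ ⌊ m ℕ.<? n ⌋
⌊∸<?∸⌋ m n o o≤m o≤n with (m ∸ o) ℕ.<? (n ∸ o) | m ℕ.<? n
... | yes _   | yes _   = refl
... | no _    | no _    = refl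
... | yes m∸o<n∸o | no m≮n = contradiction m∸o<n∸o (ℕₚ.≤⇒≯ (ℕₚ.∸-monoˡ-≤ o (ℕₚ.≮⇒≥ m≮n)))
... | no m∸o≮n∸o  | yes m<n = contradiction (ℕₚ.∸-monoˡ-< m<n o≤m) m∸o≮n∸o

module _ {n : ℕ} (r : Subset n → ℕ) where

  restrict-restrict : (A : Subset n) (S : Subset (sz A)) →
                      restrict (restrict (n , r) A) S ≅ restrict (n , r) (push A S)
  restrict-restrict A S = sym (sz-push A S) , λ T T′ T≡T′ → cong r (push-push A S T T′ T≡T′)

  contract-restrict : (A : Subset n) (S : Subset (sz A)) →
                      contract (restrict (n , r) A) S ≅ minor r (A ∩ ∁ (push A S)) (push A S)
  contract-restrict A S = ≅-trans pushed (≡⇒≅ (cong (λ B → minor r B (push A S)) (push-∁ A S)))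
    where
    pushed : contract (restrict (n , r) A) S ≅ minor r (push A (∁ S)) (push A S)
    pushed = sym (sz-push A (∁ S)) , λ T T′ T≡T′ →
      cong (λ X → r X ∸ r (push A S))
           (trans (push-∪ A (push (∁ S) T) S) (cong (_∪ push A S) (push-push A (∁ S) T T′ T≡T′)))

  restrict-contract : (C : Subset n) (S : Subset (sz (∁ C))) →
                      restrict (contract (n , r) C) S ≅ minor r (push (∁ C) S) C
  restrict-contract C S =
    sym (sz-push (∁ C) S) , λ T T′ T≡T′ → cong (λ X → r (X ∪ C) ∸ r C) (push-push (∁ C) S T T′ T≡T′)

  contract-contract : Monotone r → (C : Subset n) (S : Subset (sz (∁ C))) →
                      contract (contract (n , r) C) S ≅ minor r (∁ C ∩ ∁ (push (∁ C) S)) (push (∁ C) S ∪ C)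
  contract-contract mono C S = ≅-trans pushed (≡⇒≅ (cong (λ B → minor r B (push (∁ C) S ∪ C)) (push-∁ (∁ C) S)))
    where
    pS = push (∁ C) S
    pushed : contract (contract (n , r) C) S ≅ minor r (push (∁ C) (∁ S)) (pS ∪ C)
    pushed = sym (sz-push (∁ C) (∁ S)) , λ T T′ T≡T′ →
      trans ([m∸o]∸[n∸o]≡m∸n _ _ (r C) (mono C (pS ∪ C) (Subsetₚ.q⊆p∪q pS C)))
            (cong (λ X → r X ∸ r (pS ∪ C))
                  (trans (cong (_∪ C) (trans (push-∪ (∁ C) (push (∁ S) T) S)
                                             (cong (_∪ pS) (push-push (∁ C) (∁ S) T T′ T≡T′))))
                         (Subsetₚ.∪-assoc _ pS C)))

  deleteAt-contract : (S : Subset n) (y : Fin (sz (∁ S))) →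
                      deleteAt (contract (n , r) S) y ≅ minor r (∁ S ∩ ∁ ⁅ pushFin (∁ S) y ⁆) S
  deleteAt-contract S y =
    ≅-trans (restrict-contract S (∁ ⁅ y ⁆)) (≡⇒≅ (cong (λ B → minor r B S) (push-∁⁅⁆ (∁ S) y)))

  contractAt-restrict : (U : Subset n) (y : Fin (sz U)) →
                        contractAt (restrict (n , r) U) y ≅ minor r (U ∩ ∁ ⁅ pushFin U y ⁆) ⁅ pushFin U y ⁆
  contractAt-restrict U y =
    ≅-trans (contract-restrict U ⁅ y ⁆) (≡⇒≅ (cong (λ X → minor r (U ∩ ∁ X) X) (push-⁅⁆ U y)))

  isLoop-restrict : (U : Subset n) (y : Fin (sz U)) → isLoop (restrict (n , r) U) y ≡ isLoop (n , r) (pushFin U y)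
  isLoop-restrict U y = cong (λ X → ⌊ r X ℕ.≟ 0 ⌋) (push-⁅⁆ U y)

  isColoop-contract : Monotone r → (S : Subset n) (y : Fin (sz (∁ S))) →
                      isColoop (contract (n , r) S) y ≡ isColoop (n , r) (pushFin (∁ S) y)
  isColoop-contract mono S y =
    trans (cong₂ (λ X Y → ⌊ (r X ∸ r S) ℕ.<? (r Y ∸ r S) ⌋) ∁⁅y⁆-pushed ⊤-pushed)
          (⌊∸<?∸⌋ (r (∁ ⁅ x ⁆)) (r ⊤) (r S) (mono S (∁ ⁅ x ⁆) (⊆-∁⁅⁆ S x x∉S)) (mono S ⊤ Subsetₚ.⊆⊤))
    where
    x = pushFin (∁ S) y
    x∉S = ∉-pushFin-∁ S y
    ∁⁅y⁆-pushed : push (∁ S) (∁ ⁅ y ⁆) ∪ S ≡ ∁ ⁅ x ⁆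
    ∁⁅y⁆-pushed = begin
      push (∁ S) (∁ ⁅ y ⁆) ∪ S            ≡⟨ cong (_∪ S) (push-∁⁅⁆ (∁ S) y) ⟩
      (∁ S ∩ ∁ ⁅ x ⁆) ∪ S                 ≡⟨ Subsetₚ.∪-distribʳ-∩ S (∁ S) (∁ ⁅ x ⁆) ⟩
      (∁ S ∪ S) ∩ (∁ ⁅ x ⁆ ∪ S)           ≡⟨ cong₂ _∩_ (Subsetₚ.∪-inverseˡ S) (∁⁅⁆-∪ S x x∉S) ⟩
      ⊤ ∩ ∁ ⁅ x ⁆                         ≡⟨ Subsetₚ.∩-identityˡ _ ⟩
      ∁ ⁅ x ⁆                             ∎
      where open ≡-Reasoning
    ⊤-pushed : push (∁ S) ⊤ ∪ S ≡ ⊤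
    ⊤-pushed = trans (cong (_∪ S) (push-⊤ (∁ S))) (Subsetₚ.∪-inverseˡ S)

-- Evaluating formal combinations

weighted : (RM → ℚ) → ℚ × RM → ℚ
weighted h (q , M) = q * h M

weighted₂ : (RM → RM → ℚ) → ℚ × RM × RM → ℚ
weighted₂ g (q , A , B) = q * g A B

evalFS : (RM → ℚ) → FS → ℚ
evalFS h x = sumOver x (weighted h)

eval₂≡sumOver : (g : RM → RM → ℚ) (u : FS2) → eval₂ g u ≡ sumOver u (weighted₂ g)
eval₂≡sumOver g []      = refl
eval₂≡sumOver g (t ∷ u) = cong (weighted₂ g t +_) (eval₂≡sumOver g u)

sumOver-scaled : {A : Set} (q : ℚ) (l : List (ℚ × A)) (h : A → ℚ) →
                 sumOver (List.map (λ (c , a) → (q * c , a)) l) (λ (c , a) → c * h a) ≡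
                 q * sumOver l (λ (c , a) → c * h a)
sumOver-scaled q l h =
  trans (sumOver-map _ l _)
  (trans (sumOver-cong l (λ (c , a) → *-assoc q c (h a))) (sym (*-distribˡ-sumOver q l _)))

evalFS-linExt : (D : RM → FS) (h : RM → ℚ) (x : FS) → evalFS h (linExt D x) ≡ evalFS (λ M → evalFS h (D M)) x
evalFS-linExt D h []            = refl
evalFS-linExt D h ((q , M) ∷ x) =
  trans (sumOver-++ (List.map _ (D M)) (linExt D x) _)
        (cong₂ _+_ (sumOver-scaled q (D M) h) (evalFS-linExt D h x))

eval₂-Δ : (g : RM → RM → ℚ) (x : FS) → eval₂ g (Δ x) ≡ evalFS (eval₂ g ∘ ΔG) x
eval₂-Δ g x = trans (eval₂≡sumOver g (Δ x)) (go x)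
  where
  go : (x : FS) → sumOver (Δ x) (weighted₂ g) ≡ evalFS (eval₂ g ∘ ΔG) x
  go []            = refl
  go ((q , M) ∷ x) =
    trans (sumOver-++ (List.map _ (ΔG M)) (Δ x) _)
          (cong₂ _+_ (trans (sumOver-scaled q (ΔG M) (λ (A , B) → g A B))
                            (cong (q *_) (sym (eval₂≡sumOver g (ΔG M)))))
                     (go x))

eval₂-id⊗ : (g : RM → RM → ℚ) (D : RM → FS) (u : FS2) →
            eval₂ g (id⊗ D u) ≡ eval₂ (λ A B → neg1^ (proj₁ A) * evalFS (g A) (D B)) u
eval₂-id⊗ g D u = trans (eval₂≡sumOver g (id⊗ D u)) (trans (go u) (sym (eval₂≡sumOver _ u)))
  where
  rearrange : (s q c G : ℚ) → s * q * c * G ≡ q * (s * (c * G))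
  rearrange = solve 4 (λ s q c G → s :* q :* c :* G := q :* (s :* (c :* G))) refl
  go : (u : FS2) → sumOver (id⊗ D u) (weighted₂ g) ≡ sumOver u (weighted₂ (λ A B → neg1^ (proj₁ A) * evalFS (g A) (D B)))
  go []                = refl
  go ((q , A , B) ∷ u) =
    trans (sumOver-++ (List.map _ (D B)) (id⊗ D u) _)
    (cong₂ _+_ (trans (sumOver-map _ (D B) _)
               (trans (sumOver-cong (D B) (λ (c , B′) → rearrange (neg1^ (proj₁ A)) q c (g A B′)))
               (trans (sym (*-distribˡ-sumOver q (D B) _))
                      (cong (q *_) (sym (*-distribˡ-sumOver (neg1^ (proj₁ A)) (D B) _))))))
               (go u))

eval₂-⊗id : (g : RM → RM → ℚ) (D : RM → FS) (u : FS2) →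
            eval₂ g (⊗id D u) ≡ eval₂ (λ A B → evalFS (λ A′ → g A′ B) (D A)) u
eval₂-⊗id g D u = trans (eval₂≡sumOver g (⊗id D u)) (trans (go u) (sym (eval₂≡sumOver _ u)))
  where
  go : (u : FS2) → sumOver (⊗id D u) (weighted₂ g) ≡ sumOver u (weighted₂ (λ A B → evalFS (λ A′ → g A′ B) (D A)))
  go []                = refl
  go ((q , A , B) ∷ u) =
    trans (sumOver-++ (List.map _ (D A)) (⊗id D u) _)
          (cong₂ _+_ (trans (sumOver-map _ (D A) _)
                     (trans (sumOver-cong (D A) (λ (c , A′) → *-assoc q c (g A′ B)))
                            (sym (*-distribˡ-sumOver q (D A) _))))
                     (go u))

module _ (D : RM → FS) where

  eval₂-Δ-linExt : (g : RM → RM → ℚ) (x : FS) → eval₂ g (Δ (linExt D x)) ≡ evalFS (λ M → eval₂ g (Δ (D M))) x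
  eval₂-Δ-linExt g x =
    trans (eval₂-Δ g (linExt D x))
    (trans (evalFS-linExt D (eval₂ g ∘ ΔG) x)
           (sumOver-cong x (λ (q , M) → cong (q *_) (sym (eval₂-Δ g (D M))))))

  right-coderivation : (∀ M → IsMatroid M → Δ (D M) ≈⊗ id⊗ D (ΔG M)) →
                       ∀ x → AllMatroid x → Δ (linExt D x) ≈⊗ id⊗ D (Δ x)
  right-coderivation onGenerators x x-matroids g g-inv = begin
    eval₂ g (Δ (linExt D x))
      ≡⟨ eval₂-Δ-linExt g x ⟩
    evalFS (λ M → eval₂ g (Δ (D M))) x
      ≡⟨ sumOver-congᴬ x x-matroids (λ (q , M) isM → cong (q *_) (onGenerators M isM g g-inv)) ⟩
    evalFS (λ M → eval₂ g (id⊗ D (ΔG M))) x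
      ≡⟨ sumOver-cong x (λ (q , M) → cong (q *_) (eval₂-id⊗ g D (ΔG M))) ⟩
    evalFS (eval₂ g′ ∘ ΔG) x
      ≡⟨ eval₂-Δ g′ x ⟨
    eval₂ g′ (Δ x)
      ≡⟨ eval₂-id⊗ g D (Δ x) ⟨
    eval₂ g (id⊗ D (Δ x))
    ∎
    where
    open ≡-Reasoning
    g′ = λ A B → neg1^ (proj₁ A) * evalFS (g A) (D B)

  left-coderivation : (∀ M → IsMatroid M → Δ (D M) ≈⊗ ⊗id D (ΔG M)) →
                      ∀ x → AllMatroid x → Δ (linExt D x) ≈⊗ ⊗id D (Δ x)
  left-coderivation onGenerators x x-matroids g g-inv = begin
    eval₂ g (Δ (linExt D x))
      ≡⟨ eval₂-Δ-linExt g x ⟩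
    evalFS (λ M → eval₂ g (Δ (D M))) x
      ≡⟨ sumOver-congᴬ x x-matroids (λ (q , M) isM → cong (q *_) (onGenerators M isM g g-inv)) ⟩
    evalFS (λ M → eval₂ g (⊗id D (ΔG M))) x
      ≡⟨ sumOver-cong x (λ (q , M) → cong (q *_) (eval₂-⊗id g D (ΔG M))) ⟩
    evalFS (eval₂ g′ ∘ ΔG) x
      ≡⟨ eval₂-Δ g′ x ⟨
    eval₂ g′ (Δ x)
      ≡⟨ eval₂-⊗id g D (Δ x) ⟨
    eval₂ g (⊗id D (Δ x))
    ∎
    where
    open ≡-Reasoning
    g′ = λ A B → evalFS (λ A′ → g A′ B) (D A)

eval₂-ΔG : (h : RM → RM → ℚ) (M : RM) →
           eval₂ h (ΔG M) ≡ ∑ₛ (proj₁ M) (λ S → neg1^ (sh S) * h (restrict M S) (contract M S))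
eval₂-ΔG h M@(n , _) =
  trans (eval₂≡sumOver h (ΔG M)) (trans (sumOver-map _ (subsets n) (weighted₂ h)) (sumOver-subsets n _))

eval₂-ΔG-relabel : (g : RM → RM → ℚ) {n : ℕ} (A : Subset n) (ρ : Subset (sz A) → ℕ) (G : Subset n → ℚ) →
                   (∀ S → g (restrict (sz A , ρ) S) (contract (sz A , ρ) S) ≡ G (push A S)) →
                   eval₂ g (ΔG (sz A , ρ)) ≡ ∑ₛ n (λ S → [ S ⊆ᵇ A ]· (neg1^ (sh S ℕ.+ crossings A S) * G S))
eval₂-ΔG-relabel g A ρ G g≡G =
  trans (eval₂-ΔG g (sz A , ρ))
  (trans (∑ₛ-cong (sz A) (λ S → cong₂ _*_ (sign-push A S) (g≡G S)))
         (∑ₛ-push A (λ S → neg1^ (sh S ℕ.+ crossings A S) * G S)))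

evalFS-minorGen : (h : RM → ℚ) (sel : (M : RM) → Fin (proj₁ M) → Bool) (op : (M : RM) → Fin (proj₁ M) → RM) (M : RM) →
                  evalFS h (minorGen sel op M) ≡ sum (λ y → [ sel M y ]· (neg1^ (toℕ y) * h (op M y)))
evalFS-minorGen h sel op (n , r) =
  trans (sumOver-concatMap _ (allFin n) _)
  (trans (sumOver-allFin n _) (sum-cong-≗ (λ y → singleton (sel (n , r) y))))
  where
  singleton : ∀ {y} (b : Bool) → evalFS h (if b then (neg1^ (toℕ y) , op (n , r) y) ∷ [] else []) ≡
                                  [ b ]· (neg1^ (toℕ y) * h (op (n , r) y))
  singleton true  = +-identityʳ _
  singleton false = refl

-- Deletion

deleteBy : (Bool → Bool) → RM → FS
deleteBy f = minorGen (λ M x → f (isColoop M x)) deleteAt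

module Deletion (g : RM → RM → ℚ) (g-inv : Invariant₂ g) {n : ℕ} (r : Subset n → ℕ) (mono : Monotone r)
                (f : Bool → Bool) where

  M : RM
  M = n , r

  coloopSelected : (N : RM) → Fin (proj₁ N) → Bool
  coloopSelected N = f ∘ isColoop N

  selected : Fin n → Bool
  selected = coloopSelected M

  deleted : Fin n → Subset n → ℚ
  deleted x S = neg1^ (sh S ℕ.+ crossings (∁ ⁅ x ⁆) S) * g (restrict M S) (minor r (∁ ⁅ x ⁆ ∩ ∁ S) S)

  eval₂-ΔG-deleteAt : (x : Fin n) → eval₂ g (ΔG (deleteAt M x)) ≡ ∑ₛ n (λ S → [ not (lookup S x) ]· deleted x S)
  eval₂-ΔG-deleteAt x =
    trans (eval₂-ΔG-relabel g (∁ ⁅ x ⁆) (r ∘ push (∁ ⁅ x ⁆)) (λ S → g (restrict M S) (minor r (∁ ⁅ x ⁆ ∩ ∁ S) S))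
             (λ S → invariant-cong g g-inv (restrict-restrict r (∁ ⁅ x ⁆) S) (contract-restrict r (∁ ⁅ x ⁆) S)))
          (∑ₛ-cong n (λ S → cong (λ b → [ b ]· deleted x S) (⊆ᵇ-∁⁅⁆ S x)))

  deletedFrom : Subset n → Fin n → ℚ
  deletedFrom S x = [ selected x ]· (neg1^ (sz S ℕ.+ position (∁ S) x) * g (restrict M S) (minor r (∁ S ∩ ∁ ⁅ x ⁆) S))

  deleteBy-contract : (S : Subset n) →
                      neg1^ (sz S) * evalFS (g (restrict M S)) (deleteBy f (contract M S)) ≡
                      sum (λ x → [ lookup (∁ S) x ]· deletedFrom S x)
  deleteBy-contract S =
    trans (cong (neg1^ (sz S) *_) (evalFS-minorGen (g (restrict M S)) coloopSelected deleteAt (contract M S)))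
    (trans (*-distribˡ-sum (neg1^ (sz S)) term)
    (trans (sum-cong-≗ summand) (sum-pushFin (∁ S) (deletedFrom S))))
    where
    term : Fin (sz (∁ S)) → ℚ
    term y = [ coloopSelected (contract M S) y ]· (neg1^ (toℕ y) * g (restrict M S) (deleteAt (contract M S) y))
    summand : (y : Fin (sz (∁ S))) → neg1^ (sz S) * term y ≡ deletedFrom S (pushFin (∁ S) y)
    summand y =
      trans (*-[]· (neg1^ (sz S)) _ _)
      (cong₂ [_]·_ (cong f (isColoop-contract r mono S y))
        (trans (sym (*-assoc (neg1^ (sz S)) _ _))
               (cong₂ _*_ (trans (sym (neg1^-+ (sz S) (toℕ y))) (cong (neg1^ ∘ (sz S ℕ.+_)) (toℕ≡position-pushFin (∁ S) y)))
                          (invariant-congʳ g g-inv (restrict M S) (deleteAt-contract r S y)))))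

  summands-agree : (S : Subset n) (x : Fin n) →
                   [ selected x ]· (neg1^ (toℕ x) * [ not (lookup S x) ]· deleted x S) ≡
                   neg1^ (sh S) * [ lookup (∁ S) x ]· deletedFrom S x
  summands-agree S x rewrite Vecₚ.lookup-map x not S with lookup S x in x∈?S
  ... | true  = trans (cong [ selected x ]·_ (*-zeroʳ (neg1^ (toℕ x)))) (trans ([]·-zero _) (sym (*-zeroʳ (neg1^ (sh S)))))
  ... | false =
    trans (move-sign (selected x) (neg1^ (toℕ x)) (neg1^ (sh S ℕ.+ crossings (∁ ⁅ x ⁆) S)) (neg1^ (sh S))
                     (sign-delete S x x∈?S))
          (cong (λ B → neg1^ (sh S) * [ selected x ]· (neg1^ (sz S ℕ.+ position (∁ S) x) * g (restrict M S) (minor r B S)))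
                (Subsetₚ.∩-comm (∁ ⁅ x ⁆) (∁ S)))

  deletion-on-generator : evalFS (eval₂ g ∘ ΔG) (deleteBy f M) ≡
                          eval₂ (λ A B → neg1^ (proj₁ A) * evalFS (g A) (deleteBy f B)) (ΔG M)
  deletion-on-generator = begin
    evalFS (eval₂ g ∘ ΔG) (deleteBy f M)
      ≡⟨ evalFS-minorGen (eval₂ g ∘ ΔG) coloopSelected deleteAt M ⟩
    sum (λ x → [ selected x ]· (neg1^ (toℕ x) * eval₂ g (ΔG (deleteAt M x))))
      ≡⟨ sum-cong-≗ (λ x → cong (λ e → [ selected x ]· (neg1^ (toℕ x) * e)) (eval₂-ΔG-deleteAt x)) ⟩
    sum (λ x → [ selected x ]· (neg1^ (toℕ x) * ∑ₛ n (λ S → [ not (lookup S x) ]· deleted x S)))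
      ≡⟨ sum-cong-≗ (λ x → []·-*-∑ₛ n (selected x) (neg1^ (toℕ x)) _) ⟩
    sum (λ x → ∑ₛ n (λ S → [ selected x ]· (neg1^ (toℕ x) * [ not (lookup S x) ]· deleted x S)))
      ≡⟨ ∑-∑ₛ-comm n n _ ⟩
    ∑ₛ n (λ S → sum (λ x → [ selected x ]· (neg1^ (toℕ x) * [ not (lookup S x) ]· deleted x S)))
      ≡⟨ ∑ₛ-cong n (λ S → sum-cong-≗ (summands-agree S)) ⟩
    ∑ₛ n (λ S → sum (λ x → neg1^ (sh S) * [ lookup (∁ S) x ]· deletedFrom S x))
      ≡⟨ ∑ₛ-cong n (λ S → *-distribˡ-sum (neg1^ (sh S)) (λ x → [ lookup (∁ S) x ]· deletedFrom S x)) ⟨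
    ∑ₛ n (λ S → neg1^ (sh S) * sum (λ x → [ lookup (∁ S) x ]· deletedFrom S x))
      ≡⟨ ∑ₛ-cong n (λ S → cong (neg1^ (sh S) *_) (deleteBy-contract S)) ⟨
    ∑ₛ n (λ S → neg1^ (sh S) * (neg1^ (sz S) * evalFS (g (restrict M S)) (deleteBy f (contract M S))))
      ≡⟨ eval₂-ΔG _ M ⟨
    eval₂ (λ A B → neg1^ (proj₁ A) * evalFS (g A) (deleteBy f B)) (ΔG M)
      ∎
    where open ≡-Reasoning

-- Contraction

contractBy : (Bool → Bool) → RM → FS
contractBy f = minorGen (λ M x → f (isLoop M x)) contractAt

module Contraction (g : RM → RM → ℚ) (g-inv : Invariant₂ g) {n : ℕ} (r : Subset n → ℕ) (mono : Monotone r)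
                   (f : Bool → Bool) where

  open import Algebra.Lattice.Properties.BooleanAlgebra (Subsetₚ.∪-∩-booleanAlgebra n) using (deMorgan₂)

  M : RM
  M = n , r

  loopSelected : (N : RM) → Fin (proj₁ N) → Bool
  loopSelected N = f ∘ isLoop N

  selected : Fin n → Bool
  selected = loopSelected M

  contracted : Fin n → Subset n → ℚ
  contracted x S =
    neg1^ (sh S ℕ.+ crossings (∁ ⁅ x ⁆) S) * g (minor r S ⁅ x ⁆) (minor r (∁ ⁅ x ⁆ ∩ ∁ S) (S ∪ ⁅ x ⁆))

  eval₂-ΔG-contractAt : (x : Fin n) → eval₂ g (ΔG (contractAt M x)) ≡ ∑ₛ n (λ S → [ not (lookup S x) ]· contracted x S)
  eval₂-ΔG-contractAt x =
    trans (eval₂-ΔG-relabel g (∁ ⁅ x ⁆) (proj₂ (contractAt M x))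
             (λ S → g (minor r S ⁅ x ⁆) (minor r (∁ ⁅ x ⁆ ∩ ∁ S) (S ∪ ⁅ x ⁆)))
             (λ S → invariant-cong g g-inv (restrict-contract r ⁅ x ⁆ S) (contract-contract r mono ⁅ x ⁆ S)))
          (∑ₛ-cong n (λ S → cong (λ b → [ b ]· contracted x S) (⊆ᵇ-∁⁅⁆ S x)))

  contractedFrom : Subset n → Fin n → ℚ
  contractedFrom U x = [ selected x ]· (neg1^ (position U x) * g (minor r (U ∩ ∁ ⁅ x ⁆) ⁅ x ⁆) (contract M U))

  contractBy-restrict : (U : Subset n) →
                        evalFS (λ A → g A (contract M U)) (contractBy f (restrict M U)) ≡
                        sum (λ x → [ lookup U x ]· contractedFrom U x)
  contractBy-restrict U =
    trans (evalFS-minorGen (λ A → g A (contract M U)) loopSelected contractAt (restrict M U))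
    (trans (sum-cong-≗ summand) (sum-pushFin U (contractedFrom U)))
    where
    summand : (y : Fin (sz U)) →
              [ loopSelected (restrict M U) y ]· (neg1^ (toℕ y) * g (contractAt (restrict M U) y) (contract M U)) ≡
              contractedFrom U (pushFin U y)
    summand y =
      cong₂ [_]·_ (cong f (isLoop-restrict r U y))
                  (cong₂ _*_ (cong neg1^ (toℕ≡position-pushFin U y))
                             (invariant-congˡ g g-inv (contractAt-restrict r U y) (contract M U)))

  summands-agree : (S : Subset n) (x : Fin n) →
                   [ selected x ]· (neg1^ (toℕ x) * [ not (lookup S x) ]· contracted x S) ≡
                   [ not (lookup S x) ]· (neg1^ (sh (S ∪ ⁅ x ⁆)) * contractedFrom (S ∪ ⁅ x ⁆) x)
  summands-agree S x with lookup S x in x∈?S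
  ... | true  = trans (cong [ selected x ]·_ (*-zeroʳ (neg1^ (toℕ x)))) ([]·-zero _)
  ... | false =
    trans (move-sign (selected x) (neg1^ (toℕ x)) (neg1^ (sh S ℕ.+ crossings (∁ ⁅ x ⁆) S)) (neg1^ (sh U))
                     (sign-insert S x x∈?S))
          (cong₂ (λ B C → neg1^ (sh U) * [ selected x ]· (neg1^ (position U x) * g (minor r B ⁅ x ⁆) (minor r C U)))
                 (sym (∪⁅⁆-∩-∁⁅⁆ S x x∈?S))
                 (sym (trans (deMorgan₂ S ⁅ x ⁆) (Subsetₚ.∩-comm (∁ S) (∁ ⁅ x ⁆)))))
    where U = S ∪ ⁅ x ⁆

  contraction-on-generator : evalFS (eval₂ g ∘ ΔG) (contractBy f M) ≡
                             eval₂ (λ A B → evalFS (λ A′ → g A′ B) (contractBy f A)) (ΔG M)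
  contraction-on-generator = begin
    evalFS (eval₂ g ∘ ΔG) (contractBy f M)
      ≡⟨ evalFS-minorGen (eval₂ g ∘ ΔG) loopSelected contractAt M ⟩
    sum (λ x → [ selected x ]· (neg1^ (toℕ x) * eval₂ g (ΔG (contractAt M x))))
      ≡⟨ sum-cong-≗ (λ x → cong (λ e → [ selected x ]· (neg1^ (toℕ x) * e)) (eval₂-ΔG-contractAt x)) ⟩
    sum (λ x → [ selected x ]· (neg1^ (toℕ x) * ∑ₛ n (λ S → [ not (lookup S x) ]· contracted x S)))
      ≡⟨ sum-cong-≗ (λ x → []·-*-∑ₛ n (selected x) (neg1^ (toℕ x)) _) ⟩
    sum (λ x → ∑ₛ n (λ S → [ selected x ]· (neg1^ (toℕ x) * [ not (lookup S x) ]· contracted x S)))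
      ≡⟨ sum-cong-≗ (λ x → ∑ₛ-cong n (λ S → summands-agree S x)) ⟩
    sum (λ x → ∑ₛ n (λ S → [ not (lookup S x) ]· (neg1^ (sh (S ∪ ⁅ x ⁆)) * contractedFrom (S ∪ ⁅ x ⁆) x)))
      ≡⟨ sum-cong-≗ (λ x → ∑ₛ-insert n x (λ U → neg1^ (sh U) * contractedFrom U x)) ⟨
    sum (λ x → ∑ₛ n (λ U → [ lookup U x ]· (neg1^ (sh U) * contractedFrom U x)))
      ≡⟨ ∑-∑ₛ-comm n n _ ⟩
    ∑ₛ n (λ U → sum (λ x → [ lookup U x ]· (neg1^ (sh U) * contractedFrom U x)))
      ≡⟨ ∑ₛ-cong n (λ U → sum-cong-≗ (λ x → *-[]· (neg1^ (sh U)) (lookup U x) (contractedFrom U x))) ⟨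
    ∑ₛ n (λ U → sum (λ x → neg1^ (sh U) * [ lookup U x ]· contractedFrom U x))
      ≡⟨ ∑ₛ-cong n (λ U → *-distribˡ-sum (neg1^ (sh U)) (λ x → [ lookup U x ]· contractedFrom U x)) ⟨
    ∑ₛ n (λ U → neg1^ (sh U) * sum (λ x → [ lookup U x ]· contractedFrom U x))
      ≡⟨ ∑ₛ-cong n (λ U → cong (neg1^ (sh U) *_) (contractBy-restrict U)) ⟨
    ∑ₛ n (λ U → neg1^ (sh U) * evalFS (λ A → g A (contract M U)) (contractBy f (restrict M U)))
      ≡⟨ eval₂-ΔG _ M ⟨
    eval₂ (λ A B → evalFS (λ A′ → g A′ B) (contractBy f A)) (ΔG M)
      ∎
    where open ≡-Reasoning

-- The coderivation identities

Δ-deleteBy : (f : Bool → Bool) (M : RM) → IsMatroid M → Δ (deleteBy f M) ≈⊗ id⊗ (deleteBy f) (ΔG M)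
Δ-deleteBy f M@(_ , r) (_ , mono , _) g g-inv = begin
  eval₂ g (Δ (deleteBy f M))
    ≡⟨ eval₂-Δ g (deleteBy f M) ⟩
  evalFS (eval₂ g ∘ ΔG) (deleteBy f M)
    ≡⟨ Deletion.deletion-on-generator g g-inv r mono f ⟩
  eval₂ (λ A B → neg1^ (proj₁ A) * evalFS (g A) (deleteBy f B)) (ΔG M)
    ≡⟨ eval₂-id⊗ g (deleteBy f) (ΔG M) ⟨
  eval₂ g (id⊗ (deleteBy f) (ΔG M))
    ∎
  where open ≡-Reasoning

Δ-contractBy : (f : Bool → Bool) (M : RM) → IsMatroid M → Δ (contractBy f M) ≈⊗ ⊗id (contractBy f) (ΔG M)
Δ-contractBy f M@(_ , r) (_ , mono , _) g g-inv = begin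
  eval₂ g (Δ (contractBy f M))
    ≡⟨ eval₂-Δ g (contractBy f M) ⟩
  evalFS (eval₂ g ∘ ΔG) (contractBy f M)
    ≡⟨ Contraction.contraction-on-generator g g-inv r mono f ⟩
  eval₂ (λ A B → evalFS (λ A′ → g A′ B) (contractBy f A)) (ΔG M)
    ≡⟨ eval₂-⊗id g (contractBy f) (ΔG M) ⟨
  eval₂ g (⊗id (contractBy f) (ΔG M))
    ∎
  where open ≡-Reasoning

lemma5p10 : (x : FS) → AllMatroid x →
    ((Δ (linExt ∂delG x) ≈⊗ id⊗ ∂delG (Δ x)) ×
     (Δ (linExt ∂clpG x) ≈⊗ id⊗ ∂clpG (Δ x))) ×
    ((Δ (linExt ∂conG x) ≈⊗ ⊗id ∂conG (Δ x)) ×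
     (Δ (linExt ∂lpG x) ≈⊗ ⊗id ∂lpG (Δ x)))
lemma5p10 x x-matroids =
  ( right-coderivation ∂delG (Δ-deleteBy (notB id)) x x-matroids
  , right-coderivation ∂clpG (Δ-deleteBy id) x x-matroids ) ,
  ( left-coderivation ∂conG (Δ-contractBy (notB id)) x x-matroids
  , left-coderivation ∂lpG (Δ-contractBy id) x x-matroids )
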